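{- Let $A,B$ be two distinct letters. For every non-negative integer $n$, in $\mathbb{Q}\langle A,B\rangle$ we have \[ \sum_{r=0}^{n}(-1)^r(2r+1)\left[(AB)^{n-r}\,\text{ш}\,(AB)^{n+1+r}\right] =4^n\left(\sum_{r=0}^{n}(A^2B^2)^r\,AB\,(A^2B^2)^{n-r}+\sum_{r=1}^{n}(A^2B^2)^{r-1}\,A^2BAB^2\,(A^2B^2)^{n-r}\right). \]
   Context: $\mathbb{Q}\langle A,B\rangle$ is the $\mathbb{Q}$-vector space with basis all words (finite, possibly empty, sequences of letters) over the alphabet $\{A,B\}$, with concatenation of words written as juxtaposition; $w^k$ denotes $k$ consecutive copies of the word $w$ (so $A^2B^2=AABB$, $A^2BAB^2=AABABB$). The shuffle product ш is the bilinear operation defined on words $u=x_1\cdots x_n$, $v=x_{n+1}\cdots x_{n+m}$ by $u\,\text{ш}\,v=\sum_\sigma x_{\sigma(1)}x_{\sigma(2)}\cdots x_{\sigma(n+m)}$, the sum over all permutations $\sigma$ of $\{1,\ldots,n+m\}$ with $\sigma^{ -1}(j)<\sigma^{ -1}(k)$ whenever $1\le j<k\le n$ or $n+1\le j<k\le n+m$ (counted with multiplicity). -}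

module Defs where

open import Data.Nat using (ℕ; zero; suc; _+_; _∸_; _^_)
open import Data.List using (List; []; _∷_; _++_; map; concat; replicate; foldr; upTo; applyUpTo)
open import Data.Product using (_×_; _,_)
open import Data.Bool using (Bool; true; false; if_then_else_)
open import Data.Rational as ℚ using (ℚ; 0ℚ; 1ℚ; -_)
open import Relation.Binary.PropositionalEquality using (_≡_)
open import Data.Integer using (+_)

data Letter : Set where
  A B : Letter

_≟L_ : (x y : Letter) → Bool
A ≟L A = true
B ≟L B = true
A ≟L B = false
B ≟L A = false

Word : Set
Word = List Letter

_≟W_ : Word → Word → Bool
[] ≟W [] = true
(x ∷ u) ≟W (y ∷ v) = if x ≟L y then u ≟W v else false
_ ≟W _ = false

_^w_ : Word → ℕ → Word
w ^w zero = []
w ^w suc k = w ++ (w ^w k)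

-- Elements of ℚ⟨A,B⟩, represented as finite formal linear combinations
-- (lists of coefficient/word pairs); two representations denote the same
-- element iff every word has the same coefficient (see _≈_ below).
Poly : Set
Poly = List (ℚ × Word)

coeff : Poly → Word → ℚ
coeff [] w = 0ℚ
coeff ((c , u) ∷ p) w = if u ≟W w then c ℚ.+ coeff p w else coeff p w

_≈_ : Poly → Poly → Set
p ≈ q = ∀ (w : Word) → coeff p w ≡ coeff q w

word : Word → Poly
word w = (1ℚ , w) ∷ []

_⊕_ : Poly → Poly → Poly
p ⊕ q = p ++ q

_·_ : ℚ → Poly → Poly
c · p = map (λ { (d , u) → (c ℚ.* d , u) }) p

-- finite sum Σ_{r = 0}^{n-1} f r (applyUpTo f n = f 0 ∷ … ∷ f (n-1))
Σ< : ℕ → (ℕ → Poly) → Poly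
Σ< n f = concat (applyUpTo f n)

shuffleW : Word → Word → List Word
shuffleW [] v = v ∷ []
shuffleW (a ∷ u) [] = (a ∷ u) ∷ []
shuffleW (a ∷ u) (b ∷ v) =
  map (a ∷_) (shuffleW u (b ∷ v)) ++ map (b ∷_) (shuffleW (a ∷ u) v)

_ш_ : Word → Word → Poly
u ш v = map (λ w → (1ℚ , w)) (shuffleW u v)

sign : ℕ → ℚ
sign zero = 1ℚ
sign (suc r) = - sign r

ℕ→ℚ : ℕ → ℚ
ℕ→ℚ n = (+ n) ℚ./ 1

AB A2B2 A2BAB2 : Word
AB = A ∷ B ∷ []
A2B2 = A ∷ A ∷ B ∷ B ∷ []
A2BAB2 = A ∷ A ∷ B ∷ A ∷ B ∷ B ∷ []

-- Read as the coefficient of x^a y^b in a power series in commuting variables x, y, the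
-- coefficient of a word w in (AB)^a ш (AB)^b obeys a recursion in the letters of w: the
-- next letter is taken from one of the two factors, each of which alternates between the
-- states (AB)^a and B(AB)^a. Solving it, the series is 0 unless w is a product of blocks
-- AB and A(AB)^(j+1)B, in which case it is (x + y)^m (4xy)^e, each block AB contributing
-- x + y and each long block 4xy(x + y)^j. The left-hand side applies to these series the
-- functional P ↦ Σ_r (-1)^r (2r+1) P(n-r, n+1+r) on the antidiagonal a + b = 2n + 1. A
-- factor xy shifts this antidiagonal, and for symmetric Q two summations by parts give
-- (x + y)^2 Q ↦ 0, since the first differences of the weights (-1)^r (2r+1) are ∓2 and the
-- second ones vanish. Hence only m = 1, e = n survives, with value 4^n, and these words
-- are exactly the ones on the right-hand side.
module Submission where

open import Data.Bool using (Bool; true; false; if_then_else_; _∧_)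
open import Data.Bool.Properties using (∧-zeroʳ)
open import Data.Empty using (⊥-elim)
open import Data.Integer as ℤ using (+_)
import Data.Integer.Properties as ℤP
open import Data.List using (List; []; _∷_; _++_; map)
open import Data.List.Properties using (map-++)
open import Data.Maybe as Maybe using (Maybe; just; nothing)
open import Data.Nat using (ℕ; zero; suc; _+_; _*_; _∸_; _^_; _≡ᵇ_)
import Data.Nat.Coprimality as Coprime
open import Data.Nat.Properties using (+-comm; +-suc; +-identityʳ; m+1+n≢0; suc-injective)
open import Data.Nat.Tactic.RingSolver using (solve-∀)
open import Data.Product using (_×_; _,_; map₁; map₂)
import Data.Rational
open import Data.Rational as ℚ using (ℚ; 0ℚ; 1ℚ; mkℚ)
import Data.Rational.Properties as ℚP
open import Data.Rational.Solver using (module +-*-Solver)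
open import Relation.Binary.PropositionalEquality

open import Defs

ℕ→ℚ≡mkℚ : ∀ n → ℕ→ℚ n ≡ mkℚ (+ n) 0 (Coprime.sym (Coprime.1-coprimeTo n))
ℕ→ℚ≡mkℚ n = ℚP.normalize-coprime (Coprime.sym (Coprime.1-coprimeTo n))

ℕ→ℚ-+ : ∀ m n → ℕ→ℚ (m + n) ≡ ℕ→ℚ m ℚ.+ ℕ→ℚ n
ℕ→ℚ-+ m n =
  trans (cong₂ (λ i j → (i ℤ.+ j) ℚ./ 1) (sym (ℤP.*-identityʳ (+ m))) (sym (ℤP.*-identityʳ (+ n))))
        (sym (cong₂ ℚ._+_ (ℕ→ℚ≡mkℚ m) (ℕ→ℚ≡mkℚ n)))

ℕ→ℚ-* : ∀ m n → ℕ→ℚ (m * n) ≡ ℕ→ℚ m ℚ.* ℕ→ℚ n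
ℕ→ℚ-* m n = trans (cong (ℚ._/ 1) (ℤP.pos-* m n)) (sym (cong₂ ℚ._*_ (ℕ→ℚ≡mkℚ m) (ℕ→ℚ≡mkℚ n)))

q+q≡2*q : ∀ x → x ℚ.+ x ≡ ℕ→ℚ 2 ℚ.* x
q+q≡2*q = solve 1 (λ x → x :+ x := con (ℕ→ℚ 2) :* x) refl
  where open +-*-Solver

2q+2q≡4q : ∀ x → ℕ→ℚ 2 ℚ.* x ℚ.+ ℕ→ℚ 2 ℚ.* x ≡ ℕ→ℚ 4 ℚ.* x
2q+2q≡4q = solve 1 (λ x → con (ℕ→ℚ 2) :* x :+ con (ℕ→ℚ 2) :* x := con (ℕ→ℚ 4) :* x) refl
  where open +-*-Solver

χ : Bool → ℚ
χ b = if b then 1ℚ else 0ℚ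

sum< : ℕ → (ℕ → ℚ) → ℚ
sum< zero    f = 0ℚ
sum< (suc k) f = f 0 ℚ.+ sum< k (λ r → f (suc r))

sum<-cong : ∀ k {f g : ℕ → ℚ} → (∀ r → f r ≡ g r) → sum< k f ≡ sum< k g
sum<-cong zero    f≡g = refl
sum<-cong (suc k) f≡g = cong₂ ℚ._+_ (f≡g 0) (sum<-cong k (λ r → f≡g (suc r)))

sum<-zero : ∀ k → sum< k (λ _ → 0ℚ) ≡ 0ℚ
sum<-zero zero    = refl
sum<-zero (suc k) = trans (ℚP.+-identityˡ _) (sum<-zero k)

coeff-++ : ∀ p q w → coeff (p ++ q) w ≡ coeff p w ℚ.+ coeff q w
coeff-++ []            q w = sym (ℚP.+-identityˡ _)
coeff-++ ((c , u) ∷ p) q w with u ≟W w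
... | true  = trans (cong (c ℚ.+_) (coeff-++ p q w)) (sym (ℚP.+-assoc c _ _))
... | false = coeff-++ p q w

coeff-· : ∀ c p w → coeff (c · p) w ≡ c ℚ.* coeff p w
coeff-· c []            w = sym (ℚP.*-zeroʳ c)
coeff-· c ((d , u) ∷ p) w with u ≟W w
... | true  = trans (cong (c ℚ.* d ℚ.+_) (coeff-· c p w)) (sym (ℚP.*-distribˡ-+ c d _))
... | false = coeff-· c p w

coeff-Σ< : ∀ k f w → coeff (Σ< k f) w ≡ sum< k (λ r → coeff (f r) w)
coeff-Σ< zero    f w = refl
coeff-Σ< (suc k) f w =
  trans (coeff-++ (f 0) (Σ< k (λ r → f (suc r))) w)
        (cong (coeff (f 0) w ℚ.+_) (coeff-Σ< k (λ r → f (suc r)) w))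

coeff-word : ∀ u w → coeff (word u) w ≡ χ (u ≟W w)
coeff-word u w with u ≟W w
... | true  = refl
... | false = refl

sumOfWords : List Word → Poly
sumOfWords = map (λ w → (1ℚ , w))

coeff-sumOfWords-∷ : ∀ a c X w →
  coeff (sumOfWords (map (a ∷_) X)) (c ∷ w) ≡ (if a ≟L c then coeff (sumOfWords X) w else 0ℚ)
coeff-sumOfWords-∷ a c []      w with a ≟L c
... | true  = refl
... | false = refl
coeff-sumOfWords-∷ a c (x ∷ X) w with a ≟L c | coeff-sumOfWords-∷ a c X w
... | false | ih = ih
... | true  | ih with x ≟W w
...   | true  = cong (1ℚ ℚ.+_) ih
...   | false = ih

coeff-sumOfWords-[] : ∀ a X → coeff (sumOfWords (map (a ∷_) X)) [] ≡ 0ℚ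
coeff-sumOfWords-[] a []      = refl
coeff-sumOfWords-[] a (x ∷ X) = coeff-sumOfWords-[] a X

atLeftQuotient : Letter → Word → (Word → ℚ) → ℚ
atLeftQuotient c []      k = 0ℚ
atLeftQuotient c (x ∷ u) k = if x ≟L c then k u else 0ℚ

shuffleW-[]ʳ : ∀ u → shuffleW u [] ≡ u ∷ []
shuffleW-[]ʳ []      = refl
shuffleW-[]ʳ (x ∷ u) = refl

ш-∷-∷ : ∀ a u b v → (a ∷ u) ш (b ∷ v)
  ≡ sumOfWords (map (a ∷_) (shuffleW u (b ∷ v))) ++ sumOfWords (map (b ∷_) (shuffleW (a ∷ u) v))
ш-∷-∷ a u b v = map-++ _ (map (a ∷_) (shuffleW u (b ∷ v))) (map (b ∷_) (shuffleW (a ∷ u) v))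

coeff-ш-∷ : ∀ c w u v → coeff (u ш v) (c ∷ w)
  ≡ atLeftQuotient c u (λ u′ → coeff (u′ ш v) w)
    ℚ.+ atLeftQuotient c v (λ v′ → coeff (u ш v′) w)
coeff-ш-∷ c w []      []      = refl
coeff-ш-∷ c w []      (b ∷ v) with b ≟L c
... | true  = sym (ℚP.+-identityˡ _)
... | false = refl
coeff-ш-∷ c w (a ∷ u) []      with a ≟L c
... | true  = trans (cong (λ ws → coeff (sumOfWords ws) w) (sym (shuffleW-[]ʳ u)))
                   (sym (ℚP.+-identityʳ _))
... | false = refl
coeff-ш-∷ c w (a ∷ u) (b ∷ v) =
  trans (cong (λ p → coeff p (c ∷ w)) (ш-∷-∷ a u b v))
  (trans (coeff-++ (sumOfWords (map (a ∷_) X)) _ (c ∷ w))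
         (cong₂ ℚ._+_ (coeff-sumOfWords-∷ a c X w) (coeff-sumOfWords-∷ b c Y w)))
  where
  X = shuffleW u (b ∷ v)
  Y = shuffleW (a ∷ u) v

coeff-ш-∷-[] : ∀ a u b v → coeff ((a ∷ u) ш (b ∷ v)) [] ≡ 0ℚ
coeff-ш-∷-[] a u b v =
  trans (cong (λ p → coeff p []) (ш-∷-∷ a u b v))
  (trans (coeff-++ (sumOfWords (map (a ∷_) X)) _ [])
         (cong₂ ℚ._+_ (coeff-sumOfWords-[] a X) (coeff-sumOfWords-[] b (shuffleW (a ∷ u) v))))
  where
  X = shuffleW u (b ∷ v)

-- A table P stands for the power series Σ P a b x^a y^b in commuting variables x and y.
Table : Set
Table = ℕ → ℕ → ℚ

infix 4 _≐_
_≐_ : Table → Table → Set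
P ≐ Q = ∀ a b → P a b ≡ Q a b

zeroTable unitTable : Table
zeroTable _ _ = 0ℚ
unitTable zero    zero    = 1ℚ
unitTable zero    (suc _) = 0ℚ
unitTable (suc _) _       = 0ℚ

infixl 6 _⊞_
_⊞_ : Table → Table → Table
(P ⊞ Q) a b = P a b ℚ.+ Q a b

scale : ℚ → Table → Table
scale k P a b = k ℚ.* P a b

timesX timesY timesXY timesX+Y : Table → Table
timesX P zero    b = 0ℚ
timesX P (suc a) b = P a b
timesY P a zero    = 0ℚ
timesY P a (suc b) = P a b
timesXY P = timesX (timesY P)
timesX+Y P = timesX P ⊞ timesY P

module _ {P Q : Table} (P≐Q : P ≐ Q) where

  timesX-cong : timesX P ≐ timesX Q
  timesX-cong zero    b = refl
  timesX-cong (suc a) b = P≐Q a b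

  timesY-cong : timesY P ≐ timesY Q
  timesY-cong a zero    = refl
  timesY-cong a (suc b) = P≐Q a b

  timesX+Y-cong : timesX+Y P ≐ timesX+Y Q
  timesX+Y-cong a b = cong₂ ℚ._+_ (timesX-cong a b) (timesY-cong a b)

  scale-cong : ∀ k → scale k P ≐ scale k Q
  scale-cong k a b = cong (k ℚ.*_) (P≐Q a b)

timesXY-cong : ∀ {P Q} → P ≐ Q → timesXY P ≐ timesXY Q
timesXY-cong P≐Q = timesX-cong (timesY-cong P≐Q)

module _ (k : ℚ) (P : Table) where

  timesX-scale : timesX (scale k P) ≐ scale k (timesX P)
  timesX-scale zero    b = sym (ℚP.*-zeroʳ k)
  timesX-scale (suc a) b = refl

  timesY-scale : timesY (scale k P) ≐ scale k (timesY P)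
  timesY-scale a zero    = sym (ℚP.*-zeroʳ k)
  timesY-scale a (suc b) = refl

  timesX+Y-scale : timesX+Y (scale k P) ≐ scale k (timesX+Y P)
  timesX+Y-scale a b =
    trans (cong₂ ℚ._+_ (timesX-scale a b) (timesY-scale a b)) (sym (ℚP.*-distribˡ-+ k _ _))

  timesXY-scale : timesXY (scale k P) ≐ scale k (timesXY P)
  timesXY-scale zero    b = sym (ℚP.*-zeroʳ k)
  timesXY-scale (suc a) b = timesY-scale a b

timesYX : ∀ P → timesY (timesX P) ≐ timesXY P
timesYX P zero    zero    = refl
timesYX P zero    (suc b) = refl
timesYX P (suc a) zero    = refl
timesYX P (suc a) (suc b) = refl

timesX-zero : timesX zeroTable ≐ zeroTable
timesX-zero zero    b = refl
timesX-zero (suc a) b = refl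

timesY-zero : timesY zeroTable ≐ zeroTable
timesY-zero a zero    = refl
timesY-zero a (suc b) = refl

timesX+Y-timesXY : ∀ P → timesX+Y (timesXY P) ≐ timesXY (timesX+Y P)
timesX+Y-timesXY P zero          zero          = refl
timesX+Y-timesXY P zero          (suc b)       = refl
timesX+Y-timesXY P (suc zero)    zero          = refl
timesX+Y-timesXY P (suc zero)    (suc zero)    = refl
timesX+Y-timesXY P (suc zero)    (suc (suc b)) = refl
timesX+Y-timesXY P (suc (suc a)) zero          = refl
timesX+Y-timesXY P (suc (suc a)) (suc zero)    = refl
timesX+Y-timesXY P (suc (suc a)) (suc (suc b)) = refl

Symmetric : Table → Set
Symmetric P = ∀ i j → P i j ≡ P j i

Homogeneous : ℕ → Table → Set
Homogeneous d P = ∀ i j → i + j ≢ d → P i j ≡ 0ℚ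

timesX-transpose : ∀ {P} → Symmetric P → ∀ i j → timesX P i j ≡ timesY P j i
timesX-transpose symP zero    j = refl
timesX-transpose symP (suc i) j = symP i j

timesX+Y-symmetric : ∀ {P} → Symmetric P → Symmetric (timesX+Y P)
timesX+Y-symmetric {P} symP i j =
  trans (cong₂ ℚ._+_ (timesX-transpose symP i j) (sym (timesX-transpose symP j i)))
        (ℚP.+-comm (timesY P j i) (timesX P j i))

module _ {d P} (homP : Homogeneous d P) where

  timesX-homogeneous : Homogeneous (suc d) (timesX P)
  timesX-homogeneous zero    j _ = refl
  timesX-homogeneous (suc i) j i+j≢d = homP i j (λ eq → i+j≢d (cong suc eq))

  timesY-homogeneous : Homogeneous (suc d) (timesY P)
  timesY-homogeneous i zero    _ = refl
  timesY-homogeneous i (suc j) i+j≢d = homP i j (λ eq → i+j≢d (trans (+-suc i j) (cong suc eq)))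

  timesX+Y-homogeneous : Homogeneous (suc d) (timesX+Y P)
  timesX+Y-homogeneous i j i+j≢d =
    cong₂ ℚ._+_ (timesX-homogeneous i j i+j≢d) (timesY-homogeneous i j i+j≢d)

binomial : ℕ → Table
binomial zero    = unitTable
binomial (suc m) = timesX+Y (binomial m)

binomial-symmetric : ∀ m → Symmetric (binomial m)
binomial-symmetric zero    zero    zero    = refl
binomial-symmetric zero    zero    (suc j) = refl
binomial-symmetric zero    (suc i) zero    = refl
binomial-symmetric zero    (suc i) (suc j) = refl
binomial-symmetric (suc m) = timesX+Y-symmetric (binomial-symmetric m)

binomial-homogeneous : ∀ m → Homogeneous m (binomial m)
binomial-homogeneous zero    zero    zero    0≢0 = ⊥-elim (0≢0 refl)
binomial-homogeneous zero    zero    (suc j) _   = refl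
binomial-homogeneous zero    (suc i) j       _   = refl
binomial-homogeneous (suc m) = timesX+Y-homogeneous (binomial-homogeneous m)

series : ℕ → ℕ → Table
series m zero    = binomial m
series m (suc e) = scale (ℕ→ℚ 4) (timesXY (series m e))

series-suc : ∀ m e → timesX+Y (series m e) ≐ series (suc m) e
series-suc m zero    a b = refl
series-suc m (suc e) a b =
  trans (timesX+Y-scale (ℕ→ℚ 4) _ a b)
        (scale-cong (λ a b → trans (timesX+Y-timesXY _ a b) (timesXY-cong (series-suc m e) a b))
                    (ℕ→ℚ 4) a b)

antidiag : (ℕ → ℚ) → Table → ℕ → ℕ → ℚ
antidiag c P zero    b = c 0 ℚ.* P 0 b
antidiag c P (suc a) b = c 0 ℚ.* P (suc a) b ℚ.+ antidiag (λ i → c (suc i)) P a (suc b)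

sum<-antidiag : ∀ c P a b → sum< (suc a) (λ r → c r ℚ.* P (a ∸ r) (b + r)) ≡ antidiag c P a b
sum<-antidiag c P zero    b = trans (ℚP.+-identityʳ _) (cong (λ j → c 0 ℚ.* P 0 j) (+-identityʳ b))
sum<-antidiag c P (suc a) b = cong₂ ℚ._+_
  (cong (λ j → c 0 ℚ.* P (suc a) j) (+-identityʳ b))
  (trans (sum<-cong (suc a) (λ r → cong (λ j → c (suc r) ℚ.* P (a ∸ r) j) (+-suc b r)))
         (sum<-antidiag (λ i → c (suc i)) P a (suc b)))

antidiag-cong : ∀ c {P Q} → P ≐ Q → ∀ a b → antidiag c P a b ≡ antidiag c Q a b
antidiag-cong c P≐Q zero    b = cong (c 0 ℚ.*_) (P≐Q 0 b)
antidiag-cong c P≐Q (suc a) b =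
  cong₂ ℚ._+_ (cong (c 0 ℚ.*_) (P≐Q (suc a) b)) (antidiag-cong (λ i → c (suc i)) P≐Q a (suc b))

antidiag-scale : ∀ c k P a b → antidiag c (scale k P) a b ≡ k ℚ.* antidiag c P a b
antidiag-scale c k P zero    b = swap (c 0) k (P 0 b)
  where open +-*-Solver
        swap : ∀ c k p → c ℚ.* (k ℚ.* p) ≡ k ℚ.* (c ℚ.* p)
        swap = solve 3 (λ c k p → c :* (k :* p) := k :* (c :* p)) refl
antidiag-scale c k P (suc a) b =
  trans (cong (c 0 ℚ.* (k ℚ.* P (suc a) b) ℚ.+_) (antidiag-scale (λ i → c (suc i)) k P a (suc b)))
        (factor (c 0) k (P (suc a) b) _)
  where open +-*-Solver
        factor : ∀ c k p r → c ℚ.* (k ℚ.* p) ℚ.+ k ℚ.* r ≡ k ℚ.* (c ℚ.* p ℚ.+ r)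
        factor = solve 4 (λ c k p r → c :* (k :* p) :+ k :* r := k :* (c :* p :+ r)) refl

antidiag-timesXY : ∀ c P a b → antidiag c (timesXY P) (suc a) (suc b) ≡ antidiag c P a b
antidiag-timesXY c P zero    b =
  trans (cong (c 0 ℚ.* P 0 b ℚ.+_) (ℚP.*-zeroʳ (c 1))) (ℚP.+-identityʳ _)
antidiag-timesXY c P (suc a) b =
  cong (c 0 ℚ.* P (suc a) b ℚ.+_) (antidiag-timesXY (λ i → c (suc i)) P a (suc b))

antidiag-homogeneous : ∀ c {d P} → Homogeneous d P → ∀ a b → a + b ≢ d → antidiag c P a b ≡ 0ℚ
antidiag-homogeneous c homP zero    b b≢d =
  trans (cong (c 0 ℚ.*_) (homP 0 b b≢d)) (ℚP.*-zeroʳ (c 0))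
antidiag-homogeneous c homP (suc a) b a+b≢d = cong₂ ℚ._+_
  (trans (cong (c 0 ℚ.*_) (homP (suc a) b a+b≢d)) (ℚP.*-zeroʳ (c 0)))
  (antidiag-homogeneous (λ i → c (suc i)) homP a (suc b) (λ eq → a+b≢d (trans (sym (+-suc a b)) eq)))

antidiag-zero-weights : ∀ c → (∀ i → c i ≡ 0ℚ) → ∀ P a b → antidiag c P a b ≡ 0ℚ
antidiag-zero-weights c c≡0 P zero    b = trans (cong (ℚ._* P 0 b) (c≡0 0)) (ℚP.*-zeroˡ (P 0 b))
antidiag-zero-weights c c≡0 P (suc a) b = cong₂ ℚ._+_
  (trans (cong (ℚ._* P (suc a) b) (c≡0 0)) (ℚP.*-zeroˡ (P (suc a) b)))
  (antidiag-zero-weights (λ i → c (suc i)) (λ i → c≡0 (suc i)) P a (suc b))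

Δ : (ℕ → ℚ) → ℕ → ℚ
Δ c i = c (suc i) ℚ.+ c i

Alternating : (ℕ → ℚ) → Set
Alternating c = ∀ i → Δ c i ≡ 0ℚ

antidiag-timesX+Y : ∀ c P a b →
  antidiag c (timesX+Y P) (suc a) (suc b) ≡ c 0 ℚ.* P (suc a) b ℚ.+ antidiag (Δ c) P a (suc b)
antidiag-timesX+Y c P zero    b = base (c 0) (c 1) (P 0 (suc b)) (P 1 b)
  where open +-*-Solver
        base : ∀ c₀ c₁ x y →
          c₀ ℚ.* (x ℚ.+ y) ℚ.+ c₁ ℚ.* (0ℚ ℚ.+ x) ≡ c₀ ℚ.* y ℚ.+ (c₁ ℚ.+ c₀) ℚ.* x
        base = solve 4 (λ c₀ c₁ x y →
          c₀ :* (x :+ y) :+ c₁ :* (con 0ℚ :+ x) := c₀ :* y :+ (c₁ :+ c₀) :* x) refl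
antidiag-timesX+Y c P (suc a) b =
  trans (cong (c 0 ℚ.* timesX+Y P (suc (suc a)) (suc b) ℚ.+_)
              (antidiag-timesX+Y (λ i → c (suc i)) P a (suc b)))
        (step (c 0) (c 1) (P (suc a) (suc b)) (P (suc (suc a)) b) _)
  where open +-*-Solver
        step : ∀ c₀ c₁ x y r →
          c₀ ℚ.* (x ℚ.+ y) ℚ.+ (c₁ ℚ.* x ℚ.+ r) ≡ c₀ ℚ.* y ℚ.+ ((c₁ ℚ.+ c₀) ℚ.* x ℚ.+ r)
        step = solve 5 (λ c₀ c₁ x y r →
          c₀ :* (x :+ y) :+ (c₁ :* x :+ r) := c₀ :* y :+ ((c₁ :+ c₀) :* x :+ r)) refl

antidiag-timesX+Y-alternating : ∀ c → Alternating c → ∀ P a b →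
  antidiag c (timesX+Y P) a (suc b) ≡ c 0 ℚ.* P a b
antidiag-timesX+Y-alternating c alt P zero    b = cong (c 0 ℚ.*_) (ℚP.+-identityˡ (P 0 b))
antidiag-timesX+Y-alternating c alt P (suc a) b =
  trans (antidiag-timesX+Y c P a b)
        (trans (cong (c 0 ℚ.* P (suc a) b ℚ.+_) (antidiag-zero-weights (Δ c) alt P a (suc b)))
               (ℚP.+-identityʳ _))

weight : ℕ → ℚ
weight r = sign r ℚ.* ℕ→ℚ (2 * r + 1)

weight-Δ : ∀ i → Δ weight i ≡ sign (suc i) ℚ.* ℕ→ℚ 2
weight-Δ i = begin
  sign (suc i) ℚ.* ℕ→ℚ (2 * suc i + 1) ℚ.+ weight i
    ≡⟨ cong (λ n → sign (suc i) ℚ.* ℕ→ℚ n ℚ.+ weight i) (2[1+i]+1 i) ⟩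
  ℚ.- sign i ℚ.* ℕ→ℚ (2 * i + 1 + 2) ℚ.+ weight i
    ≡⟨ cong (λ q → ℚ.- sign i ℚ.* q ℚ.+ weight i) (ℕ→ℚ-+ (2 * i + 1) 2) ⟩
  ℚ.- sign i ℚ.* (ℕ→ℚ (2 * i + 1) ℚ.+ ℕ→ℚ 2) ℚ.+ sign i ℚ.* ℕ→ℚ (2 * i + 1)
    ≡⟨ collect (sign i) (ℕ→ℚ (2 * i + 1)) (ℕ→ℚ 2) ⟩
  sign (suc i) ℚ.* ℕ→ℚ 2 ∎
  where
  open ≡-Reasoning
  2[1+i]+1 : ∀ i → 2 * suc i + 1 ≡ 2 * i + 1 + 2
  2[1+i]+1 = solve-∀
  open +-*-Solver
  collect : ∀ s x t → ℚ.- s ℚ.* (x ℚ.+ t) ℚ.+ s ℚ.* x ≡ ℚ.- s ℚ.* t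
  collect = solve 3 (λ s x t → (:- s) :* (x :+ t) :+ s :* x := (:- s) :* t) refl

Δweight-alternating : Alternating (Δ weight)
Δweight-alternating i =
  trans (cong₂ ℚ._+_ (weight-Δ (suc i)) (weight-Δ i)) (cancel (sign (suc i)) (ℕ→ℚ 2))
  where open +-*-Solver
        cancel : ∀ s t → ℚ.- s ℚ.* t ℚ.+ s ℚ.* t ≡ 0ℚ
        cancel = solve 2 (λ s t → (:- s) :* t :+ s :* t := con 0ℚ) refl

antidiag-weight-timesX+Y² : ∀ Q → Symmetric Q → ∀ k →
  antidiag weight (timesX+Y (timesX+Y Q)) (suc k) (suc (suc k)) ≡ 0ℚ
antidiag-weight-timesX+Y² Q symQ k = begin
  antidiag weight (timesX+Y (timesX+Y Q)) (suc k) (suc (suc k))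
    ≡⟨ antidiag-timesX+Y weight (timesX+Y Q) k (suc k) ⟩
  weight 0 ℚ.* timesX+Y Q (suc k) (suc k) ℚ.+ antidiag (Δ weight) (timesX+Y Q) k (suc (suc k))
    ≡⟨ cong (weight 0 ℚ.* timesX+Y Q (suc k) (suc k) ℚ.+_)
            (antidiag-timesX+Y-alternating (Δ weight) Δweight-alternating Q k (suc k)) ⟩
  weight 0 ℚ.* (Q k (suc k) ℚ.+ Q (suc k) k) ℚ.+ Δ weight 0 ℚ.* Q k (suc k)
    ≡⟨ cong (λ q → weight 0 ℚ.* (Q k (suc k) ℚ.+ q) ℚ.+ Δ weight 0 ℚ.* Q k (suc k))
            (symQ (suc k) k) ⟩
  weight 0 ℚ.* (Q k (suc k) ℚ.+ Q k (suc k)) ℚ.+ Δ weight 0 ℚ.* Q k (suc k)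
    ≡⟨ cancel (Q k (suc k)) ⟩
  0ℚ ∎
  where
  open ≡-Reasoning
  open +-*-Solver
  cancel : ∀ x → weight 0 ℚ.* (x ℚ.+ x) ℚ.+ Δ weight 0 ℚ.* x ≡ 0ℚ
  cancel = solve 1 (λ x → con (weight 0) :* (x :+ x) :+ con (Δ weight 0) :* x := con 0ℚ) refl

antidiag-weight-binomial : ∀ m k → antidiag weight (binomial m) (suc k) (suc (suc k)) ≡ 0ℚ
antidiag-weight-binomial zero          k =
  antidiag-homogeneous weight (binomial-homogeneous 0) (suc k) (suc (suc k)) (λ ())
antidiag-weight-binomial (suc zero)    k =
  antidiag-homogeneous weight (binomial-homogeneous 1) (suc k) (suc (suc k))
                       (λ eq → m+1+n≢0 k (suc-injective eq))
antidiag-weight-binomial (suc (suc m)) k = antidiag-weight-timesX+Y² (binomial m) (binomial-symmetric m) k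

antidiag-weight-series : ∀ m e n →
  antidiag weight (series m e) n (suc n) ≡ ℕ→ℚ (4 ^ n) ℚ.* χ ((m ≡ᵇ 1) ∧ (e ≡ᵇ n))
antidiag-weight-series zero          zero    zero    = refl
antidiag-weight-series (suc zero)    zero    zero    = refl
antidiag-weight-series (suc (suc m)) zero    zero    = refl
antidiag-weight-series m             zero    (suc n) =
  trans (antidiag-weight-binomial m n)
        (sym (trans (cong (λ b → ℕ→ℚ (4 ^ suc n) ℚ.* χ b) (∧-zeroʳ (m ≡ᵇ 1)))
                    (ℚP.*-zeroʳ (ℕ→ℚ (4 ^ suc n)))))
antidiag-weight-series m             (suc e) zero    =
  sym (cong (λ b → ℕ→ℚ 1 ℚ.* χ b) (∧-zeroʳ (m ≡ᵇ 1)))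
antidiag-weight-series m             (suc e) (suc n) = begin
  antidiag weight (scale (ℕ→ℚ 4) (timesXY (series m e))) (suc n) (suc (suc n))
    ≡⟨ antidiag-scale weight (ℕ→ℚ 4) (timesXY (series m e)) (suc n) (suc (suc n)) ⟩
  ℕ→ℚ 4 ℚ.* antidiag weight (timesXY (series m e)) (suc n) (suc (suc n))
    ≡⟨ cong (ℕ→ℚ 4 ℚ.*_) (trans (antidiag-timesXY weight (series m e) n (suc n))
                                 (antidiag-weight-series m e n)) ⟩
  ℕ→ℚ 4 ℚ.* (ℕ→ℚ (4 ^ n) ℚ.* χ b)
    ≡⟨ ℚP.*-assoc (ℕ→ℚ 4) (ℕ→ℚ (4 ^ n)) (χ b) ⟨
  ℕ→ℚ 4 ℚ.* ℕ→ℚ (4 ^ n) ℚ.* χ b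
    ≡⟨ cong (ℚ._* χ b) (ℕ→ℚ-* 4 (4 ^ n)) ⟨
  ℕ→ℚ (4 ^ suc n) ℚ.* χ b ∎
  where
  open ≡-Reasoning
  b = (m ≡ᵇ 1) ∧ (e ≡ᵇ n)

data Phase : Set where
  balanced pending : Phase

power : Phase → ℕ → Word
power balanced a = AB ^w a
power pending  a = B ∷ AB ^w a

shuffleTable : Phase → Phase → Word → Table
shuffleTable s t w a b = coeff (power s a ш power t b) w

balanced²-[] : shuffleTable balanced balanced [] ≐ unitTable
balanced²-[] zero    zero    = refl
balanced²-[] zero    (suc b) = refl
balanced²-[] (suc a) zero    = refl
balanced²-[] (suc a) (suc b) = coeff-ш-∷-[] A (B ∷ AB ^w a) A (B ∷ AB ^w b)

balanced-pending-[] : shuffleTable balanced pending [] ≐ zeroTable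
balanced-pending-[] zero    b = refl
balanced-pending-[] (suc a) b = coeff-ш-∷-[] A (B ∷ AB ^w a) B (AB ^w b)

pending-balanced-[] : shuffleTable pending balanced [] ≐ zeroTable
pending-balanced-[] a zero    = refl
pending-balanced-[] a (suc b) = coeff-ш-∷-[] B (AB ^w a) A (B ∷ AB ^w b)

pending²-[] : shuffleTable pending pending [] ≐ zeroTable
pending²-[] a b = coeff-ш-∷-[] B (AB ^w a) B (AB ^w b)

shuffleTable-∷ : ∀ s t c w a b → shuffleTable s t (c ∷ w) a b
  ≡ atLeftQuotient c (power s a) (λ u → coeff (u ш power t b) w)
    ℚ.+ atLeftQuotient c (power t b) (λ v → coeff (power s a ш v) w)
shuffleTable-∷ s t c w a b = coeff-ш-∷ c w (power s a) (power t b)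

balanced²-A : ∀ w → shuffleTable balanced balanced (A ∷ w)
                  ≐ timesX (shuffleTable pending balanced w) ⊞ timesY (shuffleTable balanced pending w)
balanced²-A w zero    zero    = refl
balanced²-A w zero    (suc b) = shuffleTable-∷ balanced balanced A w zero (suc b)
balanced²-A w (suc a) zero    = shuffleTable-∷ balanced balanced A w (suc a) zero
balanced²-A w (suc a) (suc b) = shuffleTable-∷ balanced balanced A w (suc a) (suc b)

balanced²-B : ∀ w → shuffleTable balanced balanced (B ∷ w) ≐ zeroTable
balanced²-B w zero    zero    = refl
balanced²-B w zero    (suc b) = shuffleTable-∷ balanced balanced B w zero (suc b)
balanced²-B w (suc a) zero    = shuffleTable-∷ balanced balanced B w (suc a) zero
balanced²-B w (suc a) (suc b) = shuffleTable-∷ balanced balanced B w (suc a) (suc b)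

balanced-pending-A : ∀ w → shuffleTable balanced pending (A ∷ w) ≐ timesX (shuffleTable pending pending w)
balanced-pending-A w zero    b = shuffleTable-∷ balanced pending A w zero b
balanced-pending-A w (suc a) b = trans (shuffleTable-∷ balanced pending A w (suc a) b) (ℚP.+-identityʳ _)

balanced-pending-B : ∀ w → shuffleTable balanced pending (B ∷ w) ≐ shuffleTable balanced balanced w
balanced-pending-B w zero    b = trans (shuffleTable-∷ balanced pending B w zero b) (ℚP.+-identityˡ _)
balanced-pending-B w (suc a) b = trans (shuffleTable-∷ balanced pending B w (suc a) b) (ℚP.+-identityˡ _)

pending-balanced-A : ∀ w → shuffleTable pending balanced (A ∷ w) ≐ timesY (shuffleTable pending pending w)
pending-balanced-A w a zero    = shuffleTable-∷ pending balanced A w a zero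
pending-balanced-A w a (suc b) = trans (shuffleTable-∷ pending balanced A w a (suc b)) (ℚP.+-identityˡ _)

pending-balanced-B : ∀ w → shuffleTable pending balanced (B ∷ w) ≐ shuffleTable balanced balanced w
pending-balanced-B w a zero    = trans (shuffleTable-∷ pending balanced B w a zero) (ℚP.+-identityʳ _)
pending-balanced-B w a (suc b) = trans (shuffleTable-∷ pending balanced B w a (suc b)) (ℚP.+-identityʳ _)

pending²-A : ∀ w → shuffleTable pending pending (A ∷ w) ≐ zeroTable
pending²-A w a b = shuffleTable-∷ pending pending A w a b

pending²-B : ∀ w → shuffleTable pending pending (B ∷ w)
                 ≐ shuffleTable balanced pending w ⊞ shuffleTable pending balanced w
pending²-B w a b = shuffleTable-∷ pending pending B w a b

-- shape w = just (m , e) when w is a product of blocks AB and e blocks A(AB)^(j+1)B, where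
-- m counts all inner and outer AB; pendingShape and mixedShape parse the remainder of a
-- long block in the states where both factors, resp. one factor, await a B.
Shape : Set
Shape = Maybe (ℕ × ℕ)

mutual
  shape : Word → Shape
  shape []          = just (0 , 0)
  shape (A ∷ [])    = nothing
  shape (A ∷ A ∷ w) = Maybe.map (map₂ suc) (pendingShape w)
  shape (A ∷ B ∷ w) = Maybe.map (map₁ suc) (shape w)
  shape (B ∷ w)     = nothing

  pendingShape : Word → Shape
  pendingShape []      = nothing
  pendingShape (A ∷ w) = nothing
  pendingShape (B ∷ w) = mixedShape w

  mixedShape : Word → Shape
  mixedShape []      = nothing
  mixedShape (A ∷ w) = Maybe.map (map₁ suc) (pendingShape w)
  mixedShape (B ∷ w) = shape w

shapeSeries : Shape → Table
shapeSeries nothing        = zeroTable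
shapeSeries (just (m , e)) = series m e

shapeSeries-map₁ : ∀ s → timesX+Y (shapeSeries s) ≐ shapeSeries (Maybe.map (map₁ suc) s)
shapeSeries-map₁ nothing        zero    zero    = refl
shapeSeries-map₁ nothing        zero    (suc b) = refl
shapeSeries-map₁ nothing        (suc a) zero    = refl
shapeSeries-map₁ nothing        (suc a) (suc b) = refl
shapeSeries-map₁ (just (m , e)) = series-suc m e

shapeSeries-map₂ : ∀ s →
  scale (ℕ→ℚ 4) (timesXY (shapeSeries s)) ≐ shapeSeries (Maybe.map (map₂ suc) s)
shapeSeries-map₂ nothing        zero    b       = refl
shapeSeries-map₂ nothing        (suc a) zero    = refl
shapeSeries-map₂ nothing        (suc a) (suc b) = refl
shapeSeries-map₂ (just (m , e)) a       b       = refl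

balanced²-AB : ∀ w →
  shuffleTable balanced balanced (A ∷ B ∷ w) ≐ timesX+Y (shuffleTable balanced balanced w)
balanced²-AB w a b = trans (balanced²-A (B ∷ w) a b)
  (cong₂ ℚ._+_ (timesX-cong (pending-balanced-B w) a b) (timesY-cong (balanced-pending-B w) a b))

balanced²-AA : ∀ w → shuffleTable balanced balanced (A ∷ A ∷ w)
                   ≐ timesXY (shuffleTable pending pending w) ⊞ timesXY (shuffleTable pending pending w)
balanced²-AA w a b = trans (balanced²-A (A ∷ w) a b)
  (cong₂ ℚ._+_ (timesX-cong (pending-balanced-A w) a b)
               (trans (timesY-cong (balanced-pending-A w) a b)
                      (timesYX (shuffleTable pending pending w) a b)))

-- The factor 2 of the two inner states counts which of the two factors closes the long block.
mutual
  balanced²-shape : ∀ w → shuffleTable balanced balanced w ≐ shapeSeries (shape w)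
  balanced²-shape []          = balanced²-[]
  balanced²-shape (A ∷ [])    a b = trans (balanced²-A [] a b)
    (cong₂ ℚ._+_ (trans (timesX-cong pending-balanced-[] a b) (timesX-zero a b))
                 (trans (timesY-cong balanced-pending-[] a b) (timesY-zero a b)))
  balanced²-shape (A ∷ A ∷ w) a b = begin
    shuffleTable balanced balanced (A ∷ A ∷ w) a b
      ≡⟨ balanced²-AA w a b ⟩
    timesXY (shuffleTable pending pending w) a b ℚ.+ timesXY (shuffleTable pending pending w) a b
      ≡⟨ cong₂ ℚ._+_ pending-xy pending-xy ⟩
    ℕ→ℚ 2 ℚ.* timesXY S a b ℚ.+ ℕ→ℚ 2 ℚ.* timesXY S a b
      ≡⟨ 2q+2q≡4q (timesXY S a b) ⟩
    ℕ→ℚ 4 ℚ.* timesXY S a b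
      ≡⟨ shapeSeries-map₂ (pendingShape w) a b ⟩
    shapeSeries (shape (A ∷ A ∷ w)) a b ∎
    where
    open ≡-Reasoning
    S = shapeSeries (pendingShape w)
    pending-xy : timesXY (shuffleTable pending pending w) a b ≡ ℕ→ℚ 2 ℚ.* timesXY S a b
    pending-xy = trans (timesXY-cong (pending²-shape w) a b) (timesXY-scale (ℕ→ℚ 2) S a b)
  balanced²-shape (A ∷ B ∷ w) a b =
    trans (balanced²-AB w a b)
          (trans (timesX+Y-cong (balanced²-shape w) a b) (shapeSeries-map₁ (shape w) a b))
  balanced²-shape (B ∷ w)     = balanced²-B w

  pending²-shape : ∀ w →
    shuffleTable pending pending w ≐ scale (ℕ→ℚ 2) (shapeSeries (pendingShape w))
  pending²-shape []      = pending²-[]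
  pending²-shape (A ∷ w) = pending²-A w
  pending²-shape (B ∷ w) a b = trans (pending²-B w a b) (mixed-shape w a b)

  mixed-shape : ∀ w → shuffleTable balanced pending w ⊞ shuffleTable pending balanced w
                     ≐ scale (ℕ→ℚ 2) (shapeSeries (mixedShape w))
  mixed-shape []      a b = cong₂ ℚ._+_ (balanced-pending-[] a b) (pending-balanced-[] a b)
  mixed-shape (A ∷ w) a b = begin
    shuffleTable balanced pending (A ∷ w) a b ℚ.+ shuffleTable pending balanced (A ∷ w) a b
      ≡⟨ cong₂ ℚ._+_ (balanced-pending-A w a b) (pending-balanced-A w a b) ⟩
    timesX+Y (shuffleTable pending pending w) a b
      ≡⟨ timesX+Y-cong (pending²-shape w) a b ⟩
    timesX+Y (scale (ℕ→ℚ 2) S) a b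
      ≡⟨ timesX+Y-scale (ℕ→ℚ 2) S a b ⟩
    ℕ→ℚ 2 ℚ.* timesX+Y S a b
      ≡⟨ cong (ℕ→ℚ 2 ℚ.*_) (shapeSeries-map₁ (pendingShape w) a b) ⟩
    ℕ→ℚ 2 ℚ.* shapeSeries (mixedShape (A ∷ w)) a b ∎
    where
    open ≡-Reasoning
    S = shapeSeries (pendingShape w)
  mixed-shape (B ∷ w) a b =
    trans (cong₂ ℚ._+_ (trans (balanced-pending-B w a b) (balanced²-shape w a b))
                       (trans (pending-balanced-B w a b) (balanced²-shape w a b)))
          (q+q≡2*q (shapeSeries (shape w) a b))

infix 5 _≡ˢ_
_≡ˢ_ : Shape → ℕ × ℕ → Bool
nothing      ≡ˢ _         = false
just (m , e) ≡ˢ (m′ , e′) = (m ≡ᵇ m′) ∧ (e ≡ᵇ e′)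

map₁-≡ˢ-zero : ∀ s e → Maybe.map (map₁ suc) s ≡ˢ (0 , e) ≡ false
map₁-≡ˢ-zero nothing  e = refl
map₁-≡ˢ-zero (just _) e = refl

map₁-≡ˢ-suc : ∀ s m e → Maybe.map (map₁ suc) s ≡ˢ (suc m , e) ≡ s ≡ˢ (m , e)
map₁-≡ˢ-suc nothing  m e = refl
map₁-≡ˢ-suc (just _) m e = refl

map₂-≡ˢ-zero : ∀ s m → Maybe.map (map₂ suc) s ≡ˢ (m , 0) ≡ false
map₂-≡ˢ-zero nothing         m = refl
map₂-≡ˢ-zero (just (m′ , e)) m = ∧-zeroʳ (m′ ≡ᵇ m)

map₂-≡ˢ-suc : ∀ s m e → Maybe.map (map₂ suc) s ≡ˢ (m , suc e) ≡ s ≡ˢ (m , e)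
map₂-≡ˢ-suc nothing  m e = refl
map₂-≡ˢ-suc (just _) m e = refl

antidiag-weight-shapeSeries : ∀ s n →
  antidiag weight (shapeSeries s) n (suc n) ≡ ℕ→ℚ (4 ^ n) ℚ.* χ (s ≡ˢ (1 , n))
antidiag-weight-shapeSeries nothing        n =
  trans (antidiag-homogeneous weight {0} {zeroTable} (λ _ _ _ → refl) n (suc n) (m+1+n≢0 n))
        (sym (ℚP.*-zeroʳ (ℕ→ℚ (4 ^ n))))
antidiag-weight-shapeSeries (just (m , e)) n = antidiag-weight-series m e n

mutual
  A²B²-shape : ∀ k w → (A2B2 ^w k) ≟W w ≡ shape w ≡ˢ (0 , k)
  A²B²-shape zero    []          = refl
  A²B²-shape zero    (A ∷ [])    = refl
  A²B²-shape zero    (A ∷ A ∷ w) = sym (map₂-≡ˢ-zero (pendingShape w) 0)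
  A²B²-shape zero    (A ∷ B ∷ w) = sym (map₁-≡ˢ-zero (shape w) 0)
  A²B²-shape zero    (B ∷ w)     = refl
  A²B²-shape (suc k) []          = refl
  A²B²-shape (suc k) (A ∷ [])    = refl
  A²B²-shape (suc k) (A ∷ A ∷ w) = trans (B²A²B²-pendingShape k w) (sym (map₂-≡ˢ-suc (pendingShape w) 0 k))
  A²B²-shape (suc k) (A ∷ B ∷ w) = sym (map₁-≡ˢ-zero (shape w) (suc k))
  A²B²-shape (suc k) (B ∷ w)     = refl

  B²A²B²-pendingShape : ∀ k w → (B ∷ B ∷ A2B2 ^w k) ≟W w ≡ pendingShape w ≡ˢ (0 , k)
  B²A²B²-pendingShape k []          = refl
  B²A²B²-pendingShape k (A ∷ w)     = refl
  B²A²B²-pendingShape k (B ∷ [])    = refl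
  B²A²B²-pendingShape k (B ∷ A ∷ w) = sym (map₁-≡ˢ-zero (pendingShape w) k)
  B²A²B²-pendingShape k (B ∷ B ∷ w) = A²B²-shape k w

wordAB wordA²BAB² : ℕ → ℕ → Word
wordAB     n r = (A2B2 ^w r) ++ AB ++ (A2B2 ^w (n ∸ r))
wordA²BAB² n r = (A2B2 ^w r) ++ A2BAB2 ++ (A2B2 ^w (n ∸ (r + 1)))

occurrences : ℕ → Word → ℚ
occurrences n w = sum< (suc n) (λ r → χ (wordAB n r ≟W w)) ℚ.+ sum< n (λ r → χ (wordA²BAB² n r ≟W w))

padded-sums : ∀ n x y → (x ℚ.+ sum< (suc n) (λ _ → 0ℚ)) ℚ.+ (y ℚ.+ sum< n (λ _ → 0ℚ)) ≡ x ℚ.+ y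
padded-sums n x y =
  trans (cong₂ (λ s t → (x ℚ.+ s) ℚ.+ (y ℚ.+ t)) (sum<-zero (suc n)) (sum<-zero n))
        (cong₂ ℚ._+_ (ℚP.+-identityʳ x) (ℚP.+-identityʳ y))

occurrences-shape : ∀ n w → occurrences n w ≡ χ (shape w ≡ˢ (1 , n))
occurrences-shape zero    []                  = refl
occurrences-shape zero    (A ∷ [])            = refl
occurrences-shape zero    (A ∷ A ∷ w)         = cong χ (sym (map₂-≡ˢ-zero (pendingShape w) 1))
occurrences-shape zero    (A ∷ B ∷ w)         =
  trans (ℚP.+-identityʳ _) (trans (ℚP.+-identityʳ _)
        (cong χ (trans (A²B²-shape 0 w) (sym (map₁-≡ˢ-suc (shape w) 0 0)))))
occurrences-shape zero    (B ∷ w)             = refl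
occurrences-shape (suc n) []                  = padded-sums n 0ℚ 0ℚ
occurrences-shape (suc n) (A ∷ [])            = padded-sums n 0ℚ 0ℚ
occurrences-shape (suc n) (A ∷ A ∷ [])        = padded-sums n 0ℚ 0ℚ
occurrences-shape (suc n) (A ∷ A ∷ A ∷ w)     = padded-sums n 0ℚ 0ℚ
occurrences-shape (suc n) (A ∷ A ∷ B ∷ [])    = padded-sums n 0ℚ 0ℚ
occurrences-shape (suc n) (A ∷ A ∷ B ∷ A ∷ w) =
  trans (trans (padded-sums n 0ℚ y) (ℚP.+-identityˡ y))
        (cong χ (trans (B²A²B²-pendingShape n w)
                       (sym (trans (map₂-≡ˢ-suc (Maybe.map (map₁ suc) (pendingShape w)) 1 n)
                                   (map₁-≡ˢ-suc (pendingShape w) 0 n)))))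
  where y = χ ((B ∷ B ∷ A2B2 ^w n) ≟W w)
occurrences-shape (suc n) (A ∷ A ∷ B ∷ B ∷ w) =
  trans (cong₂ ℚ._+_ (ℚP.+-identityˡ (sum< (suc n) (λ r → χ (wordAB n r ≟W w))))
                     (ℚP.+-identityˡ (sum< n (λ r → χ (wordA²BAB² n r ≟W w)))))
        (trans (occurrences-shape n w) (cong χ (sym (map₂-≡ˢ-suc (shape w) 1 n))))
occurrences-shape (suc n) (A ∷ B ∷ w)         =
  trans (trans (padded-sums n x 0ℚ) (ℚP.+-identityʳ x))
        (cong χ (trans (A²B²-shape (suc n) w) (sym (map₁-≡ˢ-suc (shape w) 0 (suc n)))))
  where x = χ ((A2B2 ^w suc n) ≟W w)
occurrences-shape (suc n) (B ∷ w)             = padded-sums n 0ℚ 0ℚ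

coeff-lhs : ∀ n w →
  coeff (Σ< (n + 1) (λ r → weight r · ((AB ^w (n ∸ r)) ш (AB ^w (n + 1 + r))))) w
  ≡ antidiag weight (shuffleTable balanced balanced w) n (suc n)
coeff-lhs n w = begin
  coeff (Σ< (n + 1) (λ r → weight r · ((AB ^w (n ∸ r)) ш (AB ^w (n + 1 + r))))) w
    ≡⟨ coeff-Σ< (n + 1) _ w ⟩
  sum< (n + 1) (λ r → coeff (weight r · ((AB ^w (n ∸ r)) ш (AB ^w (n + 1 + r)))) w)
    ≡⟨ sum<-cong (n + 1) (λ r → coeff-· (weight r) ((AB ^w (n ∸ r)) ш (AB ^w (n + 1 + r))) w) ⟩
  sum< (n + 1) (λ r → weight r ℚ.* P (n ∸ r) (n + 1 + r))
    ≡⟨ cong (λ k → sum< k (λ r → weight r ℚ.* P (n ∸ r) (n + 1 + r))) (+-comm n 1) ⟩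
  sum< (suc n) (λ r → weight r ℚ.* P (n ∸ r) (n + 1 + r))
    ≡⟨ sum<-antidiag weight P n (n + 1) ⟩
  antidiag weight P n (n + 1)
    ≡⟨ cong (antidiag weight P n) (+-comm n 1) ⟩
  antidiag weight P n (suc n) ∎
  where
  open ≡-Reasoning
  P = shuffleTable balanced balanced w

coeff-rhs : ∀ n w →
  coeff (ℕ→ℚ (4 ^ n) · (Σ< (n + 1) (λ r → word (wordAB n r)) ⊕ Σ< n (λ r → word (wordA²BAB² n r)))) w
  ≡ ℕ→ℚ (4 ^ n) ℚ.* occurrences n w
coeff-rhs n w =
  trans (coeff-· (ℕ→ℚ (4 ^ n)) (S₁ ⊕ S₂) w)
        (cong (ℕ→ℚ (4 ^ n) ℚ.*_) (trans (coeff-++ S₁ S₂ w) (cong₂ ℚ._+_ coeff-S₁ coeff-S₂)))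
  where
  S₁ = Σ< (n + 1) (λ r → word (wordAB n r))
  S₂ = Σ< n (λ r → word (wordA²BAB² n r))
  coeff-S₁ : coeff S₁ w ≡ sum< (suc n) (λ r → χ (wordAB n r ≟W w))
  coeff-S₁ = trans (coeff-Σ< (n + 1) _ w)
    (trans (sum<-cong (n + 1) (λ r → coeff-word (wordAB n r) w))
           (cong (λ k → sum< k (λ r → χ (wordAB n r ≟W w))) (+-comm n 1)))
  coeff-S₂ : coeff S₂ w ≡ sum< n (λ r → χ (wordA²BAB² n r ≟W w))
  coeff-S₂ = trans (coeff-Σ< n _ w) (sum<-cong n (λ r → coeff-word (wordA²BAB² n r) w))

mainTheorem5 : (n : ℕ) →
    Σ< (n + 1) (λ r → (sign r Data.Rational.* ℕ→ℚ (2 * r + 1)) · ((AB ^w (n ∸ r)) ш (AB ^w (n + 1 + r))))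
    ≈ (ℕ→ℚ (4 ^ n) · (Σ< (n + 1) (λ r → word ((A2B2 ^w r) ++ AB ++ (A2B2 ^w (n ∸ r))))
                      ⊕ Σ< n (λ r → word ((A2B2 ^w r) ++ A2BAB2 ++ (A2B2 ^w (n ∸ (r + 1)))))))
mainTheorem5 n w =
  trans (coeff-lhs n w)
  (trans (antidiag-cong weight (balanced²-shape w) n (suc n))
  (trans (antidiag-weight-shapeSeries (shape w) n)
  (trans (cong (ℕ→ℚ (4 ^ n) ℚ.*_) (sym (occurrences-shape n w)))
         (sym (coeff-rhs n w)))))
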